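{- Let $\mathcal{G}=(\mathcal{V},\mathcal{E})$ be a graph (directed or undirected) in which every ordered (respectively unordered) pair of vertices $u,v$ has a unique shortest path $P(u,v)$, and let $\mathcal{R}=(X,\mathcal{S})$ be the set system whose ground set $X$ is the edge set $\mathcal{E}$ and whose ranges $\mathcal{S}$ are the edge sets of the shortest paths $P(u,v)$ over all pairs of vertices. Then the primal shatter function of $\mathcal{R}$ satisfies $\pi_{\mathcal{R}}(s)=O(s^2)$ for every positive integer $s$.
   Context: For a set system $\mathcal{R}=(X,\mathcal{S})$ and a positive integer $s$, the primal shatter function is $\pi_{\mathcal{R}}(s)=\max_{A\subseteq X,\ |A|=s}\left|\{A\cap S : S\in\mathcal{S}\}\right|$. -}

module Defs where

open import Data.Nat using (ℕ; _≤_)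
open import Data.Bool using (Bool; true; false)
open import Data.Fin using (Fin)
open import Data.Fin.Subset using (Subset; _∩_; ⁅_⁆; ⊥; _∪_)
open import Data.List using (List; []; _∷_; length)
open import Data.Product using (_×_; _,_; ∃; ∃-syntax)
open import Data.Sum using (_⊎_)
open import Relation.Binary.PropositionalEquality using (_≡_)

-- If 'directed = true', edge e goes from x to y; if 'directed = false',
-- edge e is the unordered edge {x , y} and can be traversed either way.
record Graph (n m : ℕ) : Set where
  field
    directed : Bool
    ends     : Fin m → Fin n × Fin n

open Graph public

Step : ∀ {n m} → Graph n m → Fin m → Fin n → Fin n → Set
Step G e u v = (ends G e ≡ (u , v)) ⊎ ((directed G ≡ false) × (ends G e ≡ (v , u)))

Simple : ∀ {n m} → Graph n m → Set
Simple {n} {m} G = ∀ (e e′ : Fin m) (u v : Fin n) → Step G e u v → Step G e′ u v → e ≡ e′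

data Walk {n m} (G : Graph n m) : Fin n → Fin n → List (Fin m) → Set where
  nil  : ∀ {u} → Walk G u u []
  cons : ∀ {u w v e es} → Step G e u w → Walk G w v es → Walk G u v (e ∷ es)

Shortest : ∀ {n m} → Graph n m → Fin n → Fin n → List (Fin m) → Set
Shortest G u v es = Walk G u v es × (∀ es′ → Walk G u v es′ → length es ≤ length es′)

-- Every ordered pair (u , v) has a unique shortest path.
-- (For undirected graphs this is the same as for unordered pairs, since
-- reversing a path gives a bijection between paths u→v and v→u.)
UniqueShortestPaths : ∀ {n m} → Graph n m → Set
UniqueShortestPaths {n} {m} G =
  ∀ (u v : Fin n) →
    (∃[ es ] Shortest G u v es) ×
    (∀ es es′ → Shortest G u v es → Shortest G u v es′ → es ≡ es′)

edgeSet : ∀ {m} → List (Fin m) → Subset m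
edgeSet []       = ⊥
edgeSet (e ∷ es) = ⁅ e ⁆ ∪ edgeSet es

IsRange : ∀ {n m} → Graph n m → Subset m → Set
IsRange {n} G S = ∃[ u ] ∃[ v ] ∃[ es ] (Shortest G u v es × S ≡ edgeSet es)

IsTrace : ∀ {n m} → Graph n m → Subset m → Subset m → Set
IsTrace G A T = ∃[ S ] (IsRange G S × T ≡ A ∩ S)

-- A shortest path P(u,v) meets A in the same edges as its infix running from the
-- tail of its first A-edge to the head of its last A-edge, and that infix is itself
-- a shortest path, hence the unique one between those two vertices.  So every
-- nonempty trace is A ∩ P(a,b) for endpoints a, b of edges of A: with |A| = s there
-- are at most 2s choices for each, so π(s) ≤ 1 + (2s)² ≤ 5s².
module Submission where

open import Defs
open import Data.Nat using (ℕ; suc; _+_; _*_; _≤_; _≥_)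
open import Data.Nat.Properties using (+-suc; *-mono-≤; +-monoʳ-≤; +-comm; +-cancelˡ-≤; +-cancelʳ-≤; module ≤-Reasoning)
open import Data.Nat.Tactic.RingSolver using (solve)
open import Data.Fin using (Fin; zero; suc)
open import Data.Fin.Properties using (injective⇒≤)
open import Data.Fin.Subset using (Subset; ∣_∣; _∩_; _∪_; ⁅_⁆; _∈_; _∉_; outside; inside) renaming (⊥ to ∅)
open import Data.Fin.Subset.Properties using (∩-distribˡ-∪; ∪-assoc; ∪-identityˡ; ∪-identityʳ; Empty-unique; x∈p∩q⁻; x∈p∪q⁻; x∈⁅y⁆⇒x≡y; ∉⊥; _∈?_)
open import Data.Vec using ([]; _∷_; here; there)
open import Data.List using (List; []; _∷_; [_]; _++_; map; length; lookup; cartesianProductWith)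
open import Data.List.Properties using (length-++; length-map)
open import Data.List.Relation.Unary.All using (All; []; _∷_)
import Data.List.Relation.Unary.All as All
open import Data.List.Relation.Unary.Any using (here; there; index)
open import Data.List.Relation.Unary.Any.Properties using (lookup-index; cartesianProductWith⁺)
open import Data.List.Relation.Unary.AllPairs using (_∷_)
open import Data.List.Relation.Unary.Unique.Propositional using (Unique)
open import Data.List.Membership.Propositional using () renaming (_∈_ to _∈ₗ_)
open import Data.List.Membership.Propositional.Properties using (∈-lookup; ∈-map⁺)
open import Data.Product using (∃-syntax; _×_; _,_; proj₁; proj₂)
import Data.Product as Product
open import Data.Sum using (_⊎_; inj₁; inj₂)
open import Data.Empty using (⊥-elim)
open import Function.Base using (_∘′_)
open import Function.Definitions using (Injective)
open import Relation.Nullary using (yes; no)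
open import Relation.Binary.PropositionalEquality using (_≡_; refl; sym; trans; cong; cong₂; subst₂; module ≡-Reasoning)

module _ {a} {X : Set a} where

  Unique⇒lookup-injective : ∀ {xs : List X} → Unique xs →
                            ∀ i j → lookup xs i ≡ lookup xs j → i ≡ j
  Unique⇒lookup-injective (_   ∷ _)  zero    zero    _  = refl
  Unique⇒lookup-injective (x≢ ∷ _)  zero    (suc j) eq = ⊥-elim (All.lookup x≢ (∈-lookup j) eq)
  Unique⇒lookup-injective (x≢ ∷ _)  (suc i) zero    eq = ⊥-elim (All.lookup x≢ (∈-lookup i) (sym eq))
  Unique⇒lookup-injective (_   ∷ u) (suc i) (suc j) eq = cong suc (Unique⇒lookup-injective u i j eq)

  Unique⇒length≤ : ∀ {xs ys : List X} → Unique xs → All (_∈ₗ ys) xs → length xs ≤ length ys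
  Unique⇒length≤ {xs} {ys} unique xs⊆ys = injective⇒≤ position-injective
    where
    position : Fin (length xs) → Fin (length ys)
    position i = index (All.lookup xs⊆ys (∈-lookup i))

    position-injective : Injective _≡_ _≡_ position
    position-injective {i} {j} eq = Unique⇒lookup-injective unique i j (begin
      lookup xs i             ≡⟨ lookup-index (All.lookup xs⊆ys (∈-lookup i)) ⟩
      lookup ys (position i)  ≡⟨ cong (lookup ys) eq ⟩
      lookup ys (position j)  ≡⟨ lookup-index (All.lookup xs⊆ys (∈-lookup j)) ⟨
      lookup xs j             ∎)
      where open ≡-Reasoning

module _ {a b c} {X : Set a} {Y : Set b} {Z : Set c} (f : X → Y → Z) where

  length-cartesianProductWith : ∀ xs ys →
    length (cartesianProductWith f xs ys) ≡ length xs * length ys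
  length-cartesianProductWith []       ys = refl
  length-cartesianProductWith (x ∷ xs) ys = trans (length-++ (map (f x) ys))
    (cong₂ _+_ (length-map (f x) ys) (length-cartesianProductWith xs ys))

elements : ∀ {m} → Subset m → List (Fin m)
elements []            = []
elements (inside  ∷ p) = zero ∷ map suc (elements p)
elements (outside ∷ p) = map suc (elements p)

length-elements : ∀ {m} (p : Subset m) → length (elements p) ≡ ∣ p ∣
length-elements []            = refl
length-elements (inside  ∷ p) = cong suc (trans (length-map suc (elements p)) (length-elements p))
length-elements (outside ∷ p) = trans (length-map suc (elements p)) (length-elements p)

∈-elements : ∀ {m} {x : Fin m} (p : Subset m) → x ∈ p → x ∈ₗ elements p
∈-elements (inside  ∷ p) here      = here refl
∈-elements (inside  ∷ p) (there q) = there (∈-map⁺ suc (∈-elements p q))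
∈-elements (outside ∷ p) (there q) = ∈-map⁺ suc (∈-elements p q)

module _ {m : ℕ} where

  ∈-edgeSet⁻ : ∀ {x : Fin m} es → x ∈ edgeSet es → x ∈ₗ es
  ∈-edgeSet⁻ []       x∈ = ⊥-elim (∉⊥ x∈)
  ∈-edgeSet⁻ (e ∷ es) x∈ with x∈p∪q⁻ ⁅ e ⁆ (edgeSet es) x∈
  ... | inj₁ x∈⁅e⁆ = here (x∈⁅y⁆⇒x≡y e x∈⁅e⁆)
  ... | inj₂ x∈es  = there (∈-edgeSet⁻ es x∈es)

  edgeSet-++ : ∀ (ps qs : List (Fin m)) → edgeSet (ps ++ qs) ≡ edgeSet ps ∪ edgeSet qs
  edgeSet-++ []       qs = sym (∪-identityˡ (edgeSet qs))
  edgeSet-++ (p ∷ ps) qs = trans (cong (⁅ p ⁆ ∪_) (edgeSet-++ ps qs))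
                                 (sym (∪-assoc ⁅ p ⁆ (edgeSet ps) (edgeSet qs)))

  Avoids : Subset m → List (Fin m) → Set
  Avoids A = All (_∉ A)

  ∩-edgeSet-avoiding : ∀ {A es} → Avoids A es → A ∩ edgeSet es ≡ ∅
  ∩-edgeSet-avoiding {A} {es} avoids = Empty-unique λ where
    (x , x∈) → let x∈A , x∈es = x∈p∩q⁻ A (edgeSet es) x∈
               in All.lookup avoids (∈-edgeSet⁻ es x∈es) x∈A

  ∩-edgeSet-infix : ∀ {A} ps qs rs → Avoids A ps → Avoids A rs →
                    A ∩ edgeSet (ps ++ qs ++ rs) ≡ A ∩ edgeSet qs
  ∩-edgeSet-infix {A} ps qs rs ps-avoids rs-avoids = begin
    A ∩ edgeSet (ps ++ qs ++ rs)
      ≡⟨ cong (A ∩_) (trans (edgeSet-++ ps (qs ++ rs)) (cong (edgeSet ps ∪_) (edgeSet-++ qs rs))) ⟩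
    A ∩ (edgeSet ps ∪ (edgeSet qs ∪ edgeSet rs))
      ≡⟨ ∩-distribˡ-∪ A (edgeSet ps) _ ⟩
    (A ∩ edgeSet ps) ∪ (A ∩ (edgeSet qs ∪ edgeSet rs))
      ≡⟨ cong₂ _∪_ (∩-edgeSet-avoiding ps-avoids) (∩-distribˡ-∪ A (edgeSet qs) (edgeSet rs)) ⟩
    ∅ ∪ ((A ∩ edgeSet qs) ∪ (A ∩ edgeSet rs))
      ≡⟨ ∪-identityˡ _ ⟩
    (A ∩ edgeSet qs) ∪ (A ∩ edgeSet rs)
      ≡⟨ cong ((A ∩ edgeSet qs) ∪_) (∩-edgeSet-avoiding rs-avoids) ⟩
    (A ∩ edgeSet qs) ∪ ∅
      ≡⟨ ∪-identityʳ _ ⟩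
    A ∩ edgeSet qs
      ∎
    where open ≡-Reasoning

module _ {n m : ℕ} (G : Graph n m) where

  Walk-++ : ∀ {u w v ps qs} → Walk G u w ps → Walk G w v qs → Walk G u v (ps ++ qs)
  Walk-++ nil              qs-walk = qs-walk
  Walk-++ (cons s ps-walk) qs-walk = cons s (Walk-++ ps-walk qs-walk)

  Shortest-infix : ∀ {u a b v ps qs rs} → Shortest G u v (ps ++ qs ++ rs) →
                   Walk G u a ps → Walk G a b qs → Walk G b v rs → Shortest G a b qs
  Shortest-infix {ps = ps} {qs} {rs} (_ , minimal) ps-walk qs-walk rs-walk = qs-walk , λ qs′ qs′-walk →
    let via-qs′ = minimal (ps ++ qs′ ++ rs) (Walk-++ ps-walk (Walk-++ qs′-walk rs-walk))
    in +-cancelʳ-≤ (length rs) (length qs) (length qs′)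
         (+-cancelˡ-≤ (length ps) _ _ (subst₂ _≤_ (length-++₃ qs) (length-++₃ qs′) via-qs′))
    where
    length-++₃ : ∀ xs → length (ps ++ xs ++ rs) ≡ length ps + (length xs + length rs)
    length-++₃ xs = trans (length-++ ps) (cong (length ps +_) (length-++ xs))

  endpoints : List (Fin m) → List (Fin n)
  endpoints []       = []
  endpoints (e ∷ es) = proj₁ (ends G e) ∷ proj₂ (ends G e) ∷ endpoints es

  length-endpoints : ∀ es → length (endpoints es) ≡ length es + length es
  length-endpoints []       = refl
  length-endpoints (e ∷ es) = cong suc (trans (cong suc (length-endpoints es))
                                              (sym (+-suc (length es) (length es))))

  Step⇒∈endpoints : ∀ {e u v es} → Step G e u v → e ∈ₗ es →
                    u ∈ₗ endpoints es × v ∈ₗ endpoints es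
  Step⇒∈endpoints (inj₁ eq)       (here refl) =
    here (sym (cong proj₁ eq)) , there (here (sym (cong proj₂ eq)))
  Step⇒∈endpoints (inj₂ (_ , eq)) (here refl) =
    there (here (sym (cong proj₂ eq))) , here (sym (cong proj₁ eq))
  Step⇒∈endpoints step (there e∈es) =
    Product.map (there ∘′ there) (there ∘′ there) (Step⇒∈endpoints step e∈es)

  module _ (A : Subset m) where

    data LastExit (x v : Fin n) : List (Fin m) → Set where
      exit : ∀ {b ps qs} → Walk G x b ps → Walk G b v qs → Avoids A qs →
             b ∈ₗ endpoints (elements A) → LastExit x v (ps ++ qs)

    data Decomposition (u v : Fin n) : List (Fin m) → Set where
      avoiding : ∀ {es} → Avoids A es → Decomposition u v es
      through  : ∀ {a b ps qs rs} → Walk G u a ps → Walk G a b qs → Walk G b v rs →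
                 Avoids A ps → Avoids A rs →
                 a ∈ₗ endpoints (elements A) → b ∈ₗ endpoints (elements A) →
                 Decomposition u v (ps ++ qs ++ rs)

    lastExit : ∀ {x v es} → Walk G x v es → Avoids A es ⊎ LastExit x v es
    lastExit nil = inj₁ []
    lastExit (cons {e = e} step walk) with lastExit walk
    ... | inj₂ (exit ps-walk qs-walk avoids b∈) = inj₂ (exit (cons step ps-walk) qs-walk avoids b∈)
    ... | inj₁ avoids with e ∈? A
    ...   | yes e∈A = inj₂ (exit (cons step nil) walk avoids
                                 (proj₂ (Step⇒∈endpoints step (∈-elements A e∈A))))
    ...   | no  e∉A = inj₁ (e∉A ∷ avoids)

    LastExit⇒Decomposition : ∀ {u v es} → u ∈ₗ endpoints (elements A) →
                             LastExit u v es → Decomposition u v es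
    LastExit⇒Decomposition u∈ (exit qs-walk rs-walk avoids b∈) = through nil qs-walk rs-walk [] avoids u∈ b∈

    decompose : ∀ {u v es} → Walk G u v es → Decomposition u v es
    decompose nil = avoiding []
    decompose (cons {e = e} step walk) with e ∈? A | lastExit (cons step walk) | decompose walk
    ... | yes e∈A | inj₁ (e∉A ∷ _) | _     = ⊥-elim (e∉A e∈A)
    ... | yes e∈A | inj₂ exits     | _     =
          LastExit⇒Decomposition (proj₁ (Step⇒∈endpoints step (∈-elements A e∈A))) exits
    ... | no  e∉A | _ | avoiding avoids = avoiding (e∉A ∷ avoids)
    ... | no  e∉A | _ | through ps-walk qs-walk rs-walk ps-avoids rs-avoids a∈ b∈ =
          through (cons step ps-walk) qs-walk rs-walk (e∉A ∷ ps-avoids) rs-avoids a∈ b∈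

    module _ (unique : UniqueShortestPaths G) where

      shortestPath : Fin n → Fin n → List (Fin m)
      shortestPath u v = proj₁ (proj₁ (unique u v))

      pathTrace : Fin n → Fin n → Subset m
      pathTrace u v = A ∩ edgeSet (shortestPath u v)

      candidateTraces : List (Subset m)
      candidateTraces =
        ∅ ∷ cartesianProductWith pathTrace (endpoints (elements A)) (endpoints (elements A))

      length-candidateTraces : length candidateTraces ≡ suc ((∣ A ∣ + ∣ A ∣) * (∣ A ∣ + ∣ A ∣))
      length-candidateTraces = cong suc (begin
        length (cartesianProductWith pathTrace VA VA) ≡⟨ length-cartesianProductWith pathTrace VA VA ⟩
        length VA * length VA                         ≡⟨ cong (λ k → k * k) length-VA ⟩
        (∣ A ∣ + ∣ A ∣) * (∣ A ∣ + ∣ A ∣)             ∎)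
        where
        open ≡-Reasoning
        VA = endpoints (elements A)
        length-VA : length VA ≡ ∣ A ∣ + ∣ A ∣
        length-VA = trans (length-endpoints (elements A)) (cong (λ k → k + k) (length-elements A))

      trace∈candidateTraces : ∀ {T} → IsTrace G A T → T ∈ₗ candidateTraces
      trace∈candidateTraces (_ , (_ , _ , _ , shortest , refl) , refl)
        with decompose (proj₁ shortest)
      ... | avoiding avoids = here (∩-edgeSet-avoiding avoids)
      ... | through {a} {b} {ps} {qs} {rs} ps-walk qs-walk rs-walk ps-avoids rs-avoids a∈ b∈ =
            there (cartesianProductWith⁺ pathTrace
                    (λ { refl refl → trans (∩-edgeSet-infix ps qs rs ps-avoids rs-avoids)
                                           (cong (λ path → A ∩ edgeSet path) qs≡P) })
                    a∈ b∈)
        where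
        qs≡P : qs ≡ shortestPath a b
        qs≡P = proj₂ (unique a b) qs (shortestPath a b)
                 (Shortest-infix shortest ps-walk qs-walk rs-walk) (proj₂ (proj₁ (unique a b)))

1+[2s]²≤5s² : ∀ s → s ≥ 1 → suc ((s + s) * (s + s)) ≤ 5 * s * s
1+[2s]²≤5s² s s≥1 = begin
  suc ((s + s) * (s + s))     ≡⟨ +-comm 1 _ ⟩
  (s + s) * (s + s) + 1       ≤⟨ +-monoʳ-≤ ((s + s) * (s + s)) (*-mono-≤ s≥1 s≥1) ⟩
  (s + s) * (s + s) + s * s   ≡⟨ solve [ s ] ⟩
  5 * s * s                   ∎
  where open ≤-Reasoning

lemma6p3 : ∃[ C ] (∀ {n m : ℕ} (G : Graph n m) → Simple G → UniqueShortestPaths G →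
    ∀ (s : ℕ) → s ≥ 1 → ∀ (A : Subset m) → ∣ A ∣ ≡ s →
    ∀ (L : List (Subset m)) → Unique L → All (IsTrace G A) L →
    length L ≤ C * s * s)
lemma6p3 = 5 , λ { G _ unique s s≥1 A refl L L-unique traces → begin
  length L                               ≤⟨ Unique⇒length≤ L-unique
                                              (All.map (trace∈candidateTraces G A unique) traces) ⟩
  length (candidateTraces G A unique)    ≡⟨ length-candidateTraces G A unique ⟩
  suc ((∣ A ∣ + ∣ A ∣) * (∣ A ∣ + ∣ A ∣))  ≤⟨ 1+[2s]²≤5s² ∣ A ∣ s≥1 ⟩
  5 * ∣ A ∣ * ∣ A ∣                      ∎ }
  where open ≤-Reasoning
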